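{- Let $n\in\mathbb N$ and regard $L_n^{(0)}$ as an $\Re$-module via $\sharp$. For $0\le i\le\lfloor n/2\rfloor$ put $u_i=v_{2i}$, and interpret $u_{ -1}$ and $u_{\lfloor n/2\rfloor+1}$ as $0$. Then for $0\le i\le \lfloor n/2\rfloor$, \[ Au_i=b_iu_{i-1}+a_iu_i+c_iu_{i+1},\qquad Bu_i=\theta_i^*u_i,\qquad Cu_i=-b_iu_{i-1}+a_iu_i-c_iu_{i+1}, \] where $a_i=\frac{n(n+2)-(n-4i)^2}{32}-\frac14$, $b_i=\frac{(n-2i+1)(n-2i+2)}{16}$, $c_i=\frac{(i+1)(2i+1)}{8}$, $\theta_i^*=\frac{(n-4i)^2}{16}-\frac14$.
   Context: $U(\mathfrak{sl}_2)$ is the $\mathbb C$-algebra generated by $E,F,H$ subject to $[H,E]=2E$, $[H,F]=-2F$, $[E,F]=H$ ($[x,y]=xy-yx$, $\mathbf i=\sqrt{ -1}$). For $n\in\mathbb N$, $L_n$ is the $U(\mathfrak{sl}_2)$-module with basis $v_0,\dots,v_n$ and $Ev_i=(n-i+1)v_{i-1}$ ($1\le i\le n$), $Ev_0=0$, $Fv_i=(i+1)v_{i+1}$ ($0\le i\le n-1$), $Fv_n=0$, $Hv_i=(n-2i)v_i$. $L_n^{(0)}$ is the span of $v_{2i}$, $0\le i\le\lfloor n/2\rfloor$ (the sum of the $H$-eigenspaces for eigenvalues $n-4i$); it is invariant under the subalgebra of $U(\mathfrak{sl}_2)$ spanned by monomials $E^iF^jH^k$ with $i-j$ even. The universal Racah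 algebra $\Re$ is generated by $A,B,C,\Delta$ subject to $[A,B]=[B,C]=[C,A]=2\Delta$ and the requirement that each of $[A,\Delta]+AC-BA$, $[B,\Delta]+BA-CB$, $[C,\Delta]+CB-AC$ is central. $\sharp:\Re\to U(\mathfrak{sl}_2)$ is the algebra homomorphism with $A\mapsto \frac{(E+F-2)(E+F+2)}{16}$, $B\mapsto\frac{(H-2)(H+2)}{16}$, $C\mapsto \frac{(\mathbf iE-\mathbf iF-2)(\mathbf iE-\mathbf iF+2)}{16}$, $\Delta\mapsto\frac{(H+2)F^2-(H-2)E^2}{64}$; its image lies in that even subalgebra, so $L_n^{(0)}$ is an $\Re$-module via $\sharp$. -}

module Defs where

open import Data.Nat as ℕ using (ℕ; zero; suc; _<ᵇ_; _≤ᵇ_)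
open import Data.Nat.DivMod using ()
open import Data.Integer as ℤ using (ℤ; +_)
open import Data.Rational as ℚ using (ℚ; _/_)
open import Data.Bool using (if_then_else_)
open import Relation.Binary.PropositionalEquality using (_≡_)

-- Gaussian rationals ℚ(𝐢) ⊆ ℂ : all scalars occurring in the statement
-- (including 𝐢 = √-1 in ♯(C)) lie in this field.

record ℚi : Set where
  constructor _+𝐢_
  field
    re : ℚ
    im : ℚ
open ℚi public

infixl 6 _⊹_
infixl 7 _⊛_

_⊹_ : ℚi → ℚi → ℚi
(a +𝐢 b) ⊹ (c +𝐢 d) = (a ℚ.+ c) +𝐢 (b ℚ.+ d)

_⊛_ : ℚi → ℚi → ℚi
(a +𝐢 b) ⊛ (c +𝐢 d) = (a ℚ.* c ℚ.- b ℚ.* d) +𝐢 (a ℚ.* d ℚ.+ b ℚ.* c)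

ι : ℚ → ℚi
ι q = q +𝐢 ℚ.0ℚ

𝐢 : ℚi
𝐢 = ℚ.0ℚ +𝐢 ℚ.1ℚ

ιℕ : ℕ → ℚi
ιℕ k = ι ((+ k) / 1)

ιℤ : ℤ → ℚi
ιℤ k = ι (k / 1)

0ᵢ : ℚi
0ᵢ = ι ℚ.0ℚ

-- Vectors of L_n: coefficient functions j ↦ coefficient of v_j
-- (meaningful for j ≤ n; the operators below never produce nonzero
-- coefficients at j > n).

Vect : Set
Vect = ℕ → ℚi

infixl 6 _+ᵥ_
_+ᵥ_ : Vect → Vect → Vect
(x +ᵥ y) j = x j ⊹ y j

_·ᵥ_ : ℚi → Vect → Vect
(c ·ᵥ x) j = c ⊛ x j

0ᵥ : Vect
0ᵥ _ = 0ᵢ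

v : ℕ → ℕ → Vect
v n k j = if (k ℕ.≤ᵇ n) then (if (j ℕ.≡ᵇ k) then ι ℚ.1ℚ else 0ᵢ) else 0ᵢ

-- E v_i = (n-i+1) v_{i-1}, E v_0 = 0 : coefficient at j is (n-j)·x(j+1) for j < n
Eop : ℕ → Vect → Vect
Eop n x j = if (j <ᵇ n) then ιℕ (n ℕ.∸ j) ⊛ x (suc j) else 0ᵢ

-- F v_i = (i+1) v_{i+1}, F v_n = 0 : coefficient at j ≥ 1 is j·x(j-1) for j ≤ n
Fop : ℕ → Vect → Vect
Fop n x zero    = 0ᵢ
Fop n x (suc j) = if (suc j ℕ.≤ᵇ n) then ιℕ (suc j) ⊛ x j else 0ᵢ

Hop : ℕ → Vect → Vect
Hop n x j = if (j ℕ.≤ᵇ n) then ιℤ (+ n ℤ.- + (2 ℕ.* j)) ⊛ x j else 0ᵢ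

-- Elements of U(sl₂), presented as noncommutative polynomial expressions
-- in E, F, H with ℚ(𝐢)-coefficients, and the representation
-- U(sl₂) → End(L_n) they induce.

infixl 6 _⊕_
infixl 7 _⊗_

data U : Set where
  E F H : U
  con   : ℚi → U
  _⊕_   : U → U → U
  _⊗_   : U → U → U

ρ : ℕ → U → Vect → Vect
ρ n E x       = Eop n x
ρ n F x       = Fop n x
ρ n H x       = Hop n x
ρ n (con c) x = c ·ᵥ x
ρ n (a ⊕ b) x = ρ n a x +ᵥ ρ n b x
ρ n (a ⊗ b) x = ρ n a (ρ n b x)

data ℜgen : Set where
  A B C Δ : ℜgen

c : ℚ → U
c q = con (ι q)

-i : ℤ → U
-i k = con (ιℤ k)

♯ : ℜgen → U
♯ A = c (+ 1 / 16) ⊗ ((E ⊕ F ⊕ -i (ℤ.- + 2)) ⊗ (E ⊕ F ⊕ -i (+ 2)))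
♯ B = c (+ 1 / 16) ⊗ ((H ⊕ -i (ℤ.- + 2)) ⊗ (H ⊕ -i (+ 2)))
♯ C = c (+ 1 / 16) ⊗ ((con 𝐢 ⊗ E ⊕ (con (ιℤ (ℤ.- + 1) ⊛ 𝐢) ⊗ F) ⊕ -i (ℤ.- + 2))
                   ⊗ (con 𝐢 ⊗ E ⊕ (con (ιℤ (ℤ.- + 1) ⊛ 𝐢) ⊗ F) ⊕ -i (+ 2)))
♯ Δ = c (+ 1 / 64) ⊗ ((H ⊕ -i (+ 2)) ⊗ F ⊗ F ⊕ -i (ℤ.- + 1) ⊗ ((H ⊕ -i (ℤ.- + 2)) ⊗ E ⊗ E))

act : ℕ → ℜgen → Vect → Vect
act n g = ρ n (♯ g)

infix 4 _≈ᵥ_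
_≈ᵥ_ : Vect → Vect → Set
x ≈ᵥ y = ∀ j → x j ≡ y j

u : ℕ → ℕ → Vect
u n i = v n (2 ℕ.* i)

uprev : ℕ → ℕ → Vect
uprev n zero    = 0ᵥ
uprev n (suc i) = u n i

unext : ℕ → ℕ → Vect
unext n i = if (suc i ℕ.≤ᵇ n ℕ./ 2) then u n (suc i) else 0ᵥ

d : ℕ → ℕ → ℤ
d n i = + n ℤ.- + (4 ℕ.* i)

acoef : ℕ → ℕ → ℚ
acoef n i = ((+ (n ℕ.* (n ℕ.+ 2)) ℤ.- d n i ℤ.* d n i) / 32) ℚ.- (+ 1 / 4)

bcoef : ℕ → ℕ → ℚ
bcoef n i = ((+ n ℤ.- + (2 ℕ.* i) ℤ.+ + 1) ℤ.* (+ n ℤ.- + (2 ℕ.* i) ℤ.+ + 2)) / 16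

ccoef : ℕ → ℕ → ℚ
ccoef n i = (+ ((suc i) ℕ.* (2 ℕ.* i ℕ.+ 1))) / 8

θ* : ℕ → ℕ → ℚ
θ* n i = (d n i ℤ.* d n i) / 16 ℚ.- (+ 1 / 4)

ℚneg : ℚ → ℚ
ℚneg = ℚ.-_

-- Extend the basis by v_k = 0 for k < 0 (as v_k = 0 for k > n already). Then for every integer k
--   E v_k = (n - k + 1) v_(k-1),   F v_k = (k + 1) v_(k+1),   H v_k = (n - 2k) v_k,
-- so X = E + F, and likewise 𝐢E - 𝐢F, is a ladder operator, and (X - 2)(X + 2) = X² - 4 maps v_k
-- into the span of v_(k-2), v_k, v_(k+2): the two v_(k±1) terms cancel. At k = 2i the three
-- coefficients, times 1/16, are b_i, a_i, c_i; for C the factors 𝐢² = (-𝐢)² = -1 flip the outer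
-- two, while 𝐢(-𝐢) = 1 leaves a_i unchanged. B is diagonal, with eigenvalue ((n-4i)² - 4)/16.
module Submission where

open import Defs
open import Data.Nat using (ℕ; _≤_; _/_)
open import Data.Product using (_×_)

open import Algebra.Bundles using (CommutativeRing)
open import Data.Bool using (true; false; if_then_else_)
open import Data.Bool.Properties using (if-eta; if-cong-then; T-≡)
open import Data.Integer as ℤ using (ℤ; +_; -[1+_])
import Data.Integer.Properties as ℤP
open import Data.Integer.Tactic.RingSolver using () renaming (solve-∀ to ℤ-solve-∀)
open import Data.Maybe using (Maybe; just; nothing)
open import Data.Nat as ℕ using (zero; suc; _<ᵇ_; _≤ᵇ_; _≡ᵇ_; _∸_)
import Data.Nat.DivMod as ℕD
import Data.Nat.Properties as ℕP
open import Data.Nat.Tactic.RingSolver using () renaming (solve-∀ to ℕ-solve-∀)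
open import Data.Product using (_,_)
open import Data.Rational as ℚ using (ℚ; toℚᵘ)
import Data.Rational.Properties as ℚP
open import Data.Rational.Unnormalised as ℚᵘ using (mkℚᵘ; *≡*)
import Data.Rational.Unnormalised.Properties as ℚᵘP
open import Function using (_∘_; Equivalence)
open import Relation.Binary.PropositionalEquality
open import Relation.Nullary using (yes; no; ofʸ; ofⁿ; contradiction)
open import Relation.Nullary.Decidable using (dec⇒maybe)
open import Tactic.RingSolver using (solve-∀)
open import Tactic.RingSolver.Core.AlmostCommutativeRing using (AlmostCommutativeRing; fromCommutativeRing)

-- ℚ(𝐢) as a commutative ring

negᵢ : ℚi → ℚi
negᵢ (a +𝐢 b) = (ℚ.- a) +𝐢 (ℚ.- b)

1ᵢ : ℚi
1ᵢ = ι ℚ.1ℚ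

ℚ-ring : AlmostCommutativeRing _ _
ℚ-ring = fromCommutativeRing ℚP.+-*-commutativeRing (λ q → dec⇒maybe (ℚ.0ℚ ℚP.≟ q))

module _ where
  open import Data.Rational using (_+_; _*_; _-_; -_)

  ⊹-assoc : ∀ x y z → (x ⊹ y) ⊹ z ≡ x ⊹ (y ⊹ z)
  ⊹-assoc (a +𝐢 b) (c +𝐢 d) (e +𝐢 f) = cong₂ _+𝐢_ (law a c e) (law b d f)
    where
    law : ∀ a c e → (a + c) + e ≡ a + (c + e)
    law = solve-∀ ℚ-ring

  ⊹-comm : ∀ x y → x ⊹ y ≡ y ⊹ x
  ⊹-comm (a +𝐢 b) (c +𝐢 d) = cong₂ _+𝐢_ (law a c) (law b d)
    where
    law : ∀ a c → a + c ≡ c + a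
    law = solve-∀ ℚ-ring

  ⊹-identityˡ : ∀ x → 0ᵢ ⊹ x ≡ x
  ⊹-identityˡ (a +𝐢 b) = cong₂ _+𝐢_ (law a) (law b)
    where
    law : ∀ a → ℚ.0ℚ + a ≡ a
    law = solve-∀ ℚ-ring

  negᵢ-inverseˡ : ∀ x → negᵢ x ⊹ x ≡ 0ᵢ
  negᵢ-inverseˡ (a +𝐢 b) = cong₂ _+𝐢_ (law a) (law b)
    where
    law : ∀ a → - a + a ≡ ℚ.0ℚ
    law = solve-∀ ℚ-ring

  ⊛-assoc : ∀ x y z → (x ⊛ y) ⊛ z ≡ x ⊛ (y ⊛ z)
  ⊛-assoc (a +𝐢 b) (c +𝐢 d) (e +𝐢 f) = cong₂ _+𝐢_ (real a b c d e f) (imag a b c d e f)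
    where
    real : ∀ a b c d e f → (a * c - b * d) * e - (a * d + b * c) * f ≡ a * (c * e - d * f) - b * (c * f + d * e)
    real = solve-∀ ℚ-ring
    imag : ∀ a b c d e f → (a * c - b * d) * f + (a * d + b * c) * e ≡ a * (c * f + d * e) + b * (c * e - d * f)
    imag = solve-∀ ℚ-ring

  ⊛-comm : ∀ x y → x ⊛ y ≡ y ⊛ x
  ⊛-comm (a +𝐢 b) (c +𝐢 d) = cong₂ _+𝐢_ (real a b c d) (imag a b c d)
    where
    real : ∀ a b c d → a * c - b * d ≡ c * a - d * b
    real = solve-∀ ℚ-ring
    imag : ∀ a b c d → a * d + b * c ≡ c * b + d * a
    imag = solve-∀ ℚ-ring

  ⊛-identityˡ : ∀ x → 1ᵢ ⊛ x ≡ x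
  ⊛-identityˡ (a +𝐢 b) = cong₂ _+𝐢_ (real a b) (imag a b)
    where
    real : ∀ a b → ℚ.1ℚ * a - ℚ.0ℚ * b ≡ a
    real = solve-∀ ℚ-ring
    imag : ∀ a b → ℚ.1ℚ * b + ℚ.0ℚ * a ≡ b
    imag = solve-∀ ℚ-ring

  ⊛-distribʳ-⊹ : ∀ x y z → (y ⊹ z) ⊛ x ≡ (y ⊛ x) ⊹ (z ⊛ x)
  ⊛-distribʳ-⊹ (a +𝐢 b) (c +𝐢 d) (e +𝐢 f) = cong₂ _+𝐢_ (real a b c d e f) (imag a b c d e f)
    where
    real : ∀ a b c d e f → (c + e) * a - (d + f) * b ≡ (c * a - d * b) + (e * a - f * b)
    real = solve-∀ ℚ-ring
    imag : ∀ a b c d e f → (c + e) * b + (d + f) * a ≡ (c * b + d * a) + (e * b + f * a)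
    imag = solve-∀ ℚ-ring

ℚi-commutativeRing : CommutativeRing _ _
ℚi-commutativeRing = record
  { Carrier = ℚi ; _≈_ = _≡_ ; _+_ = _⊹_ ; _*_ = _⊛_ ; -_ = negᵢ ; 0# = 0ᵢ ; 1# = 1ᵢ
  ; isCommutativeRing = isCommutativeRing
  }
  where
  open import Algebra.Consequences.Propositional using (comm∧idˡ⇒id; comm∧invˡ⇒inv; comm∧distrʳ⇒distrˡ)
  open import Algebra.Structures {A = ℚi} _≡_ using (IsCommutativeRing)
  isCommutativeRing : IsCommutativeRing _⊹_ _⊛_ negᵢ 0ᵢ 1ᵢ
  isCommutativeRing = record
    { isRing = record
      { +-isAbelianGroup = record
        { isGroup = record
          { isMonoid = record
            { isSemigroup = record
              { isMagma = record { isEquivalence = isEquivalence ; ∙-cong = cong₂ _⊹_ }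
              ; assoc = ⊹-assoc }
            ; identity = comm∧idˡ⇒id ⊹-comm ⊹-identityˡ }
          ; inverse = comm∧invˡ⇒inv ⊹-comm negᵢ-inverseˡ
          ; ⁻¹-cong = cong negᵢ }
        ; comm = ⊹-comm }
      ; *-cong = cong₂ _⊛_
      ; *-assoc = ⊛-assoc
      ; *-identity = comm∧idˡ⇒id ⊛-comm ⊛-identityˡ
      ; distrib = comm∧distrʳ⇒distrˡ ⊛-comm ⊛-distribʳ-⊹ , ⊛-distribʳ-⊹ }
    ; *-comm = ⊛-comm }

open CommutativeRing ℚi-commutativeRing using (zeroˡ; zeroʳ; distribˡ; distribʳ)

ℚi-ring : AlmostCommutativeRing _ _
ℚi-ring = fromCommutativeRing ℚi-commutativeRing isZero
  where
  isZero : ∀ x → Maybe (0ᵢ ≡ x)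
  isZero (a +𝐢 b) with ℚ.0ℚ ℚP.≟ a | ℚ.0ℚ ℚP.≟ b
  ... | yes a≡0 | yes b≡0 = just (cong₂ _+𝐢_ a≡0 b≡0)
  ... | _       | _       = nothing

⊛-leftComm : ∀ x y z → x ⊛ (y ⊛ z) ≡ y ⊛ (x ⊛ z)
⊛-leftComm = solve-∀ ℚi-ring

ι-homo-* : ∀ p q → ι (p ℚ.* q) ≡ ι p ⊛ ι q
ι-homo-* p q = cong₂ _+𝐢_ (real p q) (imag p q)
  where
  open import Data.Rational using (_+_; _*_; _-_)
  real : ∀ p q → p * q ≡ p * q - ℚ.0ℚ * ℚ.0ℚ
  real = solve-∀ ℚ-ring
  imag : ∀ p q → ℚ.0ℚ ≡ p * ℚ.0ℚ + ℚ.0ℚ * q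
  imag = solve-∀ ℚ-ring

toℚᵘ≃⇒≡/ : ∀ {p} z d → toℚᵘ p ℚᵘ.≃ mkℚᵘ z d → p ≡ z ℚ./ suc d
toℚᵘ≃⇒≡/ {p} z d p≃z/d = trans (sym (ℚP.fromℚᵘ-toℚᵘ p)) (ℚP.fromℚᵘ-cong p≃z/d)

toℚᵘ-/ : ∀ z d → toℚᵘ (z ℚ./ suc d) ℚᵘ.≃ mkℚᵘ z d
toℚᵘ-/ z d = ℚP.toℚᵘ-fromℚᵘ (mkℚᵘ z d)

/1-homo-+ : ∀ a b → (a ℚ./ 1) ℚ.+ (b ℚ./ 1) ≡ (a ℤ.+ b) ℚ./ 1
/1-homo-+ a b = toℚᵘ≃⇒≡/ (a ℤ.+ b) 0 (begin
  toℚᵘ ((a ℚ./ 1) ℚ.+ (b ℚ./ 1))      ≈⟨ ℚP.toℚᵘ-homo-+ (a ℚ./ 1) (b ℚ./ 1) ⟩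
  toℚᵘ (a ℚ./ 1) ℚᵘ.+ toℚᵘ (b ℚ./ 1)  ≈⟨ ℚᵘP.+-cong (toℚᵘ-/ a 0) (toℚᵘ-/ b 0) ⟩
  mkℚᵘ a 0 ℚᵘ.+ mkℚᵘ b 0              ≈⟨ *≡* (ℤ-law a b) ⟩
  mkℚᵘ (a ℤ.+ b) 0                    ∎)
  where
  open ℚᵘP.≃-Reasoning
  ℤ-law : ∀ a b → (a ℤ.* + 1 ℤ.+ b ℤ.* + 1) ℤ.* + 1 ≡ (a ℤ.+ b) ℤ.* + 1
  ℤ-law = ℤ-solve-∀

/1-homo-* : ∀ a b → (a ℚ./ 1) ℚ.* (b ℚ./ 1) ≡ (a ℤ.* b) ℚ./ 1
/1-homo-* a b = toℚᵘ≃⇒≡/ (a ℤ.* b) 0 (begin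
  toℚᵘ ((a ℚ./ 1) ℚ.* (b ℚ./ 1))      ≈⟨ ℚP.toℚᵘ-homo-* (a ℚ./ 1) (b ℚ./ 1) ⟩
  toℚᵘ (a ℚ./ 1) ℚᵘ.* toℚᵘ (b ℚ./ 1)  ≈⟨ ℚᵘP.*-cong (toℚᵘ-/ a 0) (toℚᵘ-/ b 0) ⟩
  mkℚᵘ (a ℤ.* b) 0                    ∎)
  where open ℚᵘP.≃-Reasoning

/1-homo-neg : ∀ a → ℚ.- (a ℚ./ 1) ≡ (ℤ.- a) ℚ./ 1
/1-homo-neg a = toℚᵘ≃⇒≡/ (ℤ.- a) 0 (begin
  toℚᵘ (ℚ.- (a ℚ./ 1))  ≈⟨ ℚP.toℚᵘ-homo‿- (a ℚ./ 1) ⟩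
  ℚᵘ.- toℚᵘ (a ℚ./ 1)   ≈⟨ ℚᵘP.-‿cong (toℚᵘ-/ a 0) ⟩
  mkℚᵘ (ℤ.- a) 0        ∎)
  where open ℚᵘP.≃-Reasoning

1/d*z/1≡z/d : ∀ z d → (+ 1 ℚ./ suc d) ℚ.* (z ℚ./ 1) ≡ z ℚ./ suc d
1/d*z/1≡z/d z d = toℚᵘ≃⇒≡/ z d (begin
  toℚᵘ ((+ 1 ℚ./ suc d) ℚ.* (z ℚ./ 1))      ≈⟨ ℚP.toℚᵘ-homo-* (+ 1 ℚ./ suc d) (z ℚ./ 1) ⟩
  toℚᵘ (+ 1 ℚ./ suc d) ℚᵘ.* toℚᵘ (z ℚ./ 1)  ≈⟨ ℚᵘP.*-cong (toℚᵘ-/ (+ 1) d) (toℚᵘ-/ z 0) ⟩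
  mkℚᵘ (+ 1 ℤ.* z) (d ℕ.* 1)                ≈⟨ *≡* (cong₂ (λ x y → x ℤ.* + suc y) (ℤP.*-identityˡ z)
                                                                                  (sym (ℕP.*-identityʳ d))) ⟩
  mkℚᵘ z d                                  ∎)
  where open ℚᵘP.≃-Reasoning

ιℤ-homo-+ : ∀ a b → ιℤ (a ℤ.+ b) ≡ ιℤ a ⊹ ιℤ b
ιℤ-homo-+ a b = cong ι (sym (/1-homo-+ a b))

ιℤ-homo-* : ∀ a b → ιℤ (a ℤ.* b) ≡ ιℤ a ⊛ ιℤ b
ιℤ-homo-* a b = trans (cong ι (sym (/1-homo-* a b))) (ι-homo-* (a ℚ./ 1) (b ℚ./ 1))

ιℤ-homo-neg : ∀ a → ιℤ (ℤ.- a) ≡ negᵢ (ιℤ a)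
ιℤ-homo-neg a = cong ι (sym (/1-homo-neg a))

ι-/ : ∀ z d → ι (z ℚ./ suc d) ≡ ι (+ 1 ℚ./ suc d) ⊛ ιℤ z
ι-/ z d = trans (cong ι (sym (1/d*z/1≡z/d z d))) (ι-homo-* (+ 1 ℚ./ suc d) (z ℚ./ 1))

-- Linearity of ρ

if-⊛-zero : ∀ b c {x} → x ≡ 0ᵢ → (if b then c ⊛ x else 0ᵢ) ≡ 0ᵢ
if-⊛-zero b c x≡0 = trans (if-cong-then b (trans (cong (c ⊛_) x≡0) (zeroʳ c))) (if-eta b)

if-⊛-distrib : ∀ b c x y → (if b then c ⊛ (x ⊹ y) else 0ᵢ) ≡ (if b then c ⊛ x else 0ᵢ) ⊹ (if b then c ⊛ y else 0ᵢ)
if-⊛-distrib true  c x y = distribˡ c x y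
if-⊛-distrib false c x y = refl

if-⊛-scale : ∀ b c s x → (if b then c ⊛ (s ⊛ x) else 0ᵢ) ≡ s ⊛ (if b then c ⊛ x else 0ᵢ)
if-⊛-scale true  c s x = ⊛-leftComm c s x
if-⊛-scale false c s x = sym (zeroʳ s)

ρ-cong : ∀ n a {x y} → x ≈ᵥ y → ρ n a x ≈ᵥ ρ n a y
ρ-cong n E       x≈y j       = cong (λ t → if j <ᵇ n then ιℕ (n ∸ j) ⊛ t else 0ᵢ) (x≈y (suc j))
ρ-cong n F       x≈y zero    = refl
ρ-cong n F       x≈y (suc j) = cong (λ t → if suc j ≤ᵇ n then ιℕ (suc j) ⊛ t else 0ᵢ) (x≈y j)
ρ-cong n H       x≈y j       = cong (λ t → if j ≤ᵇ n then ιℤ (+ n ℤ.- + (2 ℕ.* j)) ⊛ t else 0ᵢ) (x≈y j)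
ρ-cong n (con c) x≈y j       = cong (c ⊛_) (x≈y j)
ρ-cong n (a ⊕ b) x≈y j       = cong₂ _⊹_ (ρ-cong n a x≈y j) (ρ-cong n b x≈y j)
ρ-cong n (a ⊗ b) x≈y         = ρ-cong n a (ρ-cong n b x≈y)

ρ-+ᵥ : ∀ n a x y → ρ n a (x +ᵥ y) ≈ᵥ ρ n a x +ᵥ ρ n a y
ρ-+ᵥ n E       x y j       = if-⊛-distrib (j <ᵇ n) (ιℕ (n ∸ j)) (x (suc j)) (y (suc j))
ρ-+ᵥ n F       x y zero    = refl
ρ-+ᵥ n F       x y (suc j) = if-⊛-distrib (suc j ≤ᵇ n) (ιℕ (suc j)) (x j) (y j)
ρ-+ᵥ n H       x y j       = if-⊛-distrib (j ≤ᵇ n) (ιℤ (+ n ℤ.- + (2 ℕ.* j))) (x j) (y j)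
ρ-+ᵥ n (con c) x y j       = distribˡ c (x j) (y j)
ρ-+ᵥ n (a ⊕ b) x y j       =
  trans (cong₂ _⊹_ (ρ-+ᵥ n a x y j) (ρ-+ᵥ n b x y j)) (middleFour (ρ n a x j) (ρ n a y j) (ρ n b x j) (ρ n b y j))
  where
  middleFour : ∀ p q r s → (p ⊹ q) ⊹ (r ⊹ s) ≡ (p ⊹ r) ⊹ (q ⊹ s)
  middleFour = solve-∀ ℚi-ring
ρ-+ᵥ n (a ⊗ b) x y j       = trans (ρ-cong n a (ρ-+ᵥ n b x y) j) (ρ-+ᵥ n a (ρ n b x) (ρ n b y) j)

ρ-·ᵥ : ∀ n a s x → ρ n a (s ·ᵥ x) ≈ᵥ s ·ᵥ ρ n a x
ρ-·ᵥ n E       s x j       = if-⊛-scale (j <ᵇ n) (ιℕ (n ∸ j)) s (x (suc j))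
ρ-·ᵥ n F       s x zero    = sym (zeroʳ s)
ρ-·ᵥ n F       s x (suc j) = if-⊛-scale (suc j ≤ᵇ n) (ιℕ (suc j)) s (x j)
ρ-·ᵥ n H       s x j       = if-⊛-scale (j ≤ᵇ n) (ιℤ (+ n ℤ.- + (2 ℕ.* j))) s (x j)
ρ-·ᵥ n (con c) s x j       = ⊛-leftComm c s (x j)
ρ-·ᵥ n (a ⊕ b) s x j       = trans (cong₂ _⊹_ (ρ-·ᵥ n a s x j) (ρ-·ᵥ n b s x j)) (sym (distribˡ s (ρ n a x j) (ρ n b x j)))
ρ-·ᵥ n (a ⊗ b) s x j       = trans (ρ-cong n a (ρ-·ᵥ n b s x) j) (ρ-·ᵥ n a s (ρ n b x) j)

ρ-0ᵥ : ∀ n a → ρ n a 0ᵥ ≈ᵥ 0ᵥ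
ρ-0ᵥ n a j = trans (ρ-·ᵥ n a 0ᵢ 0ᵥ j) (zeroˡ (ρ n a 0ᵥ j))

ρ-combination : ∀ n a p q r x y z →
  ρ n a (p ·ᵥ x +ᵥ q ·ᵥ y +ᵥ r ·ᵥ z) ≈ᵥ p ·ᵥ ρ n a x +ᵥ q ·ᵥ ρ n a y +ᵥ r ·ᵥ ρ n a z
ρ-combination n a p q r x y z j =
  trans (ρ-+ᵥ n a (p ·ᵥ x +ᵥ q ·ᵥ y) (r ·ᵥ z) j)
        (cong₂ _⊹_ (trans (ρ-+ᵥ n a (p ·ᵥ x) (q ·ᵥ y) j) (cong₂ _⊹_ (ρ-·ᵥ n a p x j) (ρ-·ᵥ n a q y j)))
                   (ρ-·ᵥ n a r z j))

SupportedAt : ℕ → Vect → Set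
SupportedAt m x = ∀ {j} → j ≢ m → x j ≡ 0ᵢ

≈ᵥ-by-support : ∀ {m x y} → SupportedAt m x → SupportedAt m y → x m ≡ y m → x ≈ᵥ y
≈ᵥ-by-support {m} sx sy xm≡ym j with j ℕ.≟ m
... | yes refl = xm≡ym
... | no  j≢m  = trans (sx j≢m) (sym (sy j≢m))

·ᵥ-supported : ∀ {m x} c → SupportedAt m x → SupportedAt m (c ·ᵥ x)
·ᵥ-supported c sx j≢m = trans (cong (c ⊛_) (sx j≢m)) (zeroʳ c)

v-supported : ∀ n m → SupportedAt m (v n m)
v-supported n m {j} j≢m with j ≡ᵇ m | ℕP.≡ᵇ⇒≡ j m
... | true  | ≡ᵇ⇒≡ = contradiction (≡ᵇ⇒≡ _) j≢m
... | false | _    = if-eta (m ≤ᵇ n)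

v-diagonal : ∀ n m → v n m m ≡ (if m ≤ᵇ n then 1ᵢ else 0ᵢ)
v-diagonal n m rewrite Equivalence.to T-≡ (ℕP.≡⇒≡ᵇ m m refl) = refl

v-beyond : ∀ {n m} → n ℕ.< m → v n m ≈ᵥ 0ᵥ
v-beyond {n} {m} n<m j with m ≤ᵇ n | ℕP.≤ᵇ-reflects-≤ m n
... | true  | ofʸ m≤n = contradiction m≤n (ℕP.<⇒≱ n<m)
... | false | _       = refl

E-supported : ∀ {n m x} → SupportedAt (suc m) x → SupportedAt m (ρ n E x)
E-supported {n} sx {j} j≢m = if-⊛-zero (j <ᵇ n) (ιℕ (n ∸ j)) (sx (j≢m ∘ ℕP.suc-injective))

F-supported : ∀ {n m x} → SupportedAt m x → SupportedAt (suc m) (ρ n F x)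
F-supported     sx {zero}  _   = refl
F-supported {n} sx {suc j} j≢m = if-⊛-zero (suc j ≤ᵇ n) (ιℕ (suc j)) (sx (j≢m ∘ cong suc))

H-supported : ∀ {n m x} → SupportedAt m x → SupportedAt m (ρ n H x)
H-supported {n} sx {j} j≢m = if-⊛-zero (j ≤ᵇ n) (ιℤ (+ n ℤ.- + (2 ℕ.* j))) (sx j≢m)

E-v : ∀ n m → ρ n E (v n (suc m)) ≈ᵥ ιℤ (+ n ℤ.- + m) ·ᵥ v n m
E-v n m = ≈ᵥ-by-support (E-supported (v-supported n (suc m))) (·ᵥ-supported κ (v-supported n m)) diagonal
  where
  κ = ιℤ (+ n ℤ.- + m)
  diagonal : (if m <ᵇ n then ιℕ (n ∸ m) ⊛ v n (suc m) (suc m) else 0ᵢ) ≡ κ ⊛ v n m m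
  diagonal rewrite v-diagonal n (suc m) | v-diagonal n m
    with m <ᵇ n | ℕP.<ᵇ-reflects-< m n | m ≤ᵇ n | ℕP.≤ᵇ-reflects-≤ m n
  ... | true  | ofʸ m<n | true  | _       =
    cong (λ z → ιℤ z ⊛ 1ᵢ) (sym (trans (ℤP.m-n≡m⊖n n m) (ℤP.⊖-≥ (ℕP.<⇒≤ m<n))))
  ... | true  | ofʸ m<n | false | ofⁿ m≰n = contradiction (ℕP.<⇒≤ m<n) m≰n
  ... | false | ofⁿ m≮n | true  | ofʸ m≤n
    rewrite ℕP.≤-antisym m≤n (ℕP.≮⇒≥ m≮n) = cong (λ z → ιℤ z ⊛ 1ᵢ) (sym (ℤP.+-inverseʳ (+ n)))
  ... | false | ofⁿ _   | false | _       = sym (zeroʳ κ)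

F-v : ∀ n m → ρ n F (v n m) ≈ᵥ ιℕ (suc m) ·ᵥ v n (suc m)
F-v n m = ≈ᵥ-by-support (F-supported (v-supported n m)) (·ᵥ-supported κ (v-supported n (suc m))) diagonal
  where
  κ = ιℕ (suc m)
  diagonal : (if m <ᵇ n then κ ⊛ v n m m else 0ᵢ) ≡ κ ⊛ v n (suc m) (suc m)
  diagonal rewrite v-diagonal n (suc m) | v-diagonal n m with m <ᵇ n | ℕP.<ᵇ-reflects-< m n
  ... | true  | ofʸ m<n rewrite Equivalence.to T-≡ (ℕP.≤⇒≤ᵇ (ℕP.<⇒≤ m<n)) = refl
  ... | false | _       = sym (zeroʳ κ)

H-v : ∀ n m → ρ n H (v n m) ≈ᵥ ιℤ (+ n ℤ.- + (2 ℕ.* m)) ·ᵥ v n m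
H-v n m = ≈ᵥ-by-support (H-supported (v-supported n m)) (·ᵥ-supported κ (v-supported n m)) diagonal
  where
  κ = ιℤ (+ n ℤ.- + (2 ℕ.* m))
  diagonal : (if m ≤ᵇ n then κ ⊛ v n m m else 0ᵢ) ≡ κ ⊛ v n m m
  diagonal rewrite v-diagonal n m with m ≤ᵇ n
  ... | true  = refl
  ... | false = sym (zeroʳ κ)

-- Ladder operators

vℤ : ℕ → ℤ → Vect
vℤ n (+ m)    = v n m
vℤ n -[1+ _ ] = 0ᵥ

record Shifts (n : ℕ) (e : U) (α : ℤ → ℚi) (σ : ℤ → ℤ) : Set where
  field shift : ∀ k → ρ n e (vℤ n k) ≈ᵥ α k ·ᵥ vℤ n (σ k)
open Shifts

Shifts-scale : ∀ {n e α σ} s → Shifts n e α σ → Shifts n (con s ⊗ e) (λ k → s ⊛ α k) σ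
Shifts-scale {n} {e} {α} {σ} s e-shifts .shift k j =
  trans (cong (s ⊛_) (e-shifts .shift k j)) (sym (⊛-assoc s (α k) (vℤ n (σ k) j)))

lowering : ℕ → ℤ → ℚi
lowering n k = ιℤ (+ n ℤ.- ℤ.pred k)

raising : ℤ → ℚi
raising k = ιℤ (ℤ.suc k)

E-lowers : ∀ n → Shifts n E (lowering n) ℤ.pred
E-lowers n .shift (+ suc m)  = E-v n m
E-lowers n .shift (+ zero) j = trans (if-⊛-zero (j <ᵇ n) (ιℕ (n ∸ j)) refl) (sym (zeroʳ (lowering n (+ 0))))
E-lowers n .shift -[1+ m ] j = trans (ρ-0ᵥ n E j) (sym (zeroʳ (lowering n -[1+ m ])))

F-raises : ∀ n → Shifts n F raising ℤ.suc
F-raises n .shift (+ m)           = F-v n m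
F-raises n .shift -[1+ zero ]  j  = trans (ρ-0ᵥ n F j) (sym (zeroˡ (v n 0 j)))
F-raises n .shift -[1+ suc m ] j  = trans (ρ-0ᵥ n F j) (sym (zeroʳ (raising -[1+ suc m ])))

ladder-square : ∀ {n e f α β} → Shifts n e α ℤ.pred → Shifts n f β ℤ.suc → ∀ γ k →
  ρ n ((e ⊕ f ⊕ con γ) ⊗ (e ⊕ f ⊕ con (negᵢ γ))) (vℤ n k) ≈ᵥ
    (α k ⊛ α (ℤ.pred k)) ·ᵥ vℤ n (ℤ.pred (ℤ.pred k))
    +ᵥ (α k ⊛ β (ℤ.pred k) ⊹ β k ⊛ α (ℤ.suc k) ⊹ negᵢ (γ ⊛ γ)) ·ᵥ vℤ n k
    +ᵥ (β k ⊛ β (ℤ.suc k)) ·ᵥ vℤ n (ℤ.suc (ℤ.suc k))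
ladder-square {n} {e} {f} {α} {β} e-lowers f-raises γ k j = begin
  ρ n P (ρ n Q (vℤ n k)) j
    ≡⟨ ρ-cong n P (ladder (negᵢ γ) k refl refl) j ⟩
  ρ n P (α k ·ᵥ vℤ n (ℤ.pred k) +ᵥ β k ·ᵥ vℤ n (ℤ.suc k) +ᵥ negᵢ γ ·ᵥ vℤ n k) j
    ≡⟨ ρ-combination n P (α k) (β k) (negᵢ γ) (vℤ n (ℤ.pred k)) (vℤ n (ℤ.suc k)) (vℤ n k) j ⟩
  α k ⊛ ρ n P (vℤ n (ℤ.pred k)) j ⊹ β k ⊛ ρ n P (vℤ n (ℤ.suc k)) j ⊹ negᵢ γ ⊛ ρ n P (vℤ n k) j
    ≡⟨ cong₂ _⊹_ (cong₂ _⊹_ (cong (α k ⊛_) (ladder γ (ℤ.pred k) refl (ℤP.suc-pred k) j))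
                            (cong (β k ⊛_) (ladder γ (ℤ.suc k) (ℤP.pred-suc k) refl j)))
                 (cong (negᵢ γ ⊛_) (ladder γ k refl refl j)) ⟩
  α k ⊛ (α (ℤ.pred k) ⊛ w₋₂ ⊹ β (ℤ.pred k) ⊛ w₀ ⊹ γ ⊛ w₋₁)
    ⊹ β k ⊛ (α (ℤ.suc k) ⊛ w₀ ⊹ β (ℤ.suc k) ⊛ w₂ ⊹ γ ⊛ w₁)
    ⊹ negᵢ γ ⊛ (α k ⊛ w₋₁ ⊹ β k ⊛ w₁ ⊹ γ ⊛ w₀)
    ≡⟨ expand (α k) (α (ℤ.pred k)) (α (ℤ.suc k)) (β k) (β (ℤ.pred k)) (β (ℤ.suc k)) γ w₋₂ w₋₁ w₀ w₁ w₂ ⟩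
  (α k ⊛ α (ℤ.pred k)) ⊛ w₋₂ ⊹ (α k ⊛ β (ℤ.pred k) ⊹ β k ⊛ α (ℤ.suc k) ⊹ negᵢ (γ ⊛ γ)) ⊛ w₀
    ⊹ (β k ⊛ β (ℤ.suc k)) ⊛ w₂ ∎
  where
  open ≡-Reasoning
  P = e ⊕ f ⊕ con γ
  Q = e ⊕ f ⊕ con (negᵢ γ)
  w₋₂ = vℤ n (ℤ.pred (ℤ.pred k)) j
  w₋₁ = vℤ n (ℤ.pred k) j
  w₀  = vℤ n k j
  w₁  = vℤ n (ℤ.suc k) j
  w₂  = vℤ n (ℤ.suc (ℤ.suc k)) j

  ladder : ∀ δ k {k₋ k₊} → ℤ.pred k ≡ k₋ → ℤ.suc k ≡ k₊ →
    ρ n (e ⊕ f ⊕ con δ) (vℤ n k) ≈ᵥ α k ·ᵥ vℤ n k₋ +ᵥ β k ·ᵥ vℤ n k₊ +ᵥ δ ·ᵥ vℤ n k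
  ladder δ k refl refl j = cong (_⊹ δ ⊛ vℤ n k j) (cong₂ _⊹_ (e-lowers .shift k j) (f-raises .shift k j))

  expand : ∀ a a₋ a₊ b b₋ b₊ g x₋₂ x₋₁ x₀ x₁ x₂ →
    a ⊛ (a₋ ⊛ x₋₂ ⊹ b₋ ⊛ x₀ ⊹ g ⊛ x₋₁) ⊹ b ⊛ (a₊ ⊛ x₀ ⊹ b₊ ⊛ x₂ ⊹ g ⊛ x₁) ⊹ negᵢ g ⊛ (a ⊛ x₋₁ ⊹ b ⊛ x₁ ⊹ g ⊛ x₀)
      ≡ (a ⊛ a₋) ⊛ x₋₂ ⊹ (a ⊛ b₋ ⊹ b ⊛ a₊ ⊹ negᵢ (g ⊛ g)) ⊛ x₀ ⊹ (b ⊛ b₊) ⊛ x₂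
  expand = solve-∀ ℚi-ring

uprev≈vℤ : ∀ n i → uprev n i ≈ᵥ vℤ n (ℤ.pred (ℤ.pred (+ (2 ℕ.* i))))
uprev≈vℤ n zero    j = refl
uprev≈vℤ n (suc i) j = cong (λ m → vℤ n (ℤ.pred (ℤ.pred (+ m))) j) (sym (ℕP.*-suc 2 i))

unext≈vℤ : ∀ n i → unext n i ≈ᵥ vℤ n (ℤ.suc (ℤ.suc (+ (2 ℕ.* i))))
unext≈vℤ n i j with suc i ≤ᵇ n / 2 | ℕP.≤ᵇ-reflects-≤ (suc i) (n / 2)
... | true  | _         = cong (λ m → v n m j) (ℕP.*-suc 2 i)
... | false | ofⁿ i≰n/2 =
  sym (trans (cong (λ m → v n m j) (sym (ℕP.*-suc 2 i))) (v-beyond (ℕP.≰⇒> (i≰n/2 ∘ half-mono)) j))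
  where
  half-mono : 2 ℕ.* suc i ≤ n → suc i ≤ n / 2
  half-mono 2i+2≤n = subst (_≤ n / 2) (ℕD.m*n/n≡m (suc i) 2)
                           (ℕD./-monoˡ-≤ 2 (subst (_≤ n) (ℕP.*-comm 2 (suc i)) 2i+2≤n))

ladder-square-on-u : ∀ {n e f α β} → Shifts n e α ℤ.pred → Shifts n f β ℤ.suc → ∀ s γ i {b a c} →
  let k = + (2 ℕ.* i) in
  s ⊛ (α k ⊛ α (ℤ.pred k)) ≡ b →
  s ⊛ (α k ⊛ β (ℤ.pred k) ⊹ β k ⊛ α (ℤ.suc k) ⊹ negᵢ (γ ⊛ γ)) ≡ a →
  s ⊛ (β k ⊛ β (ℤ.suc k)) ≡ c →
  ρ n (con s ⊗ ((e ⊕ f ⊕ con γ) ⊗ (e ⊕ f ⊕ con (negᵢ γ)))) (u n i) ≈ᵥ b ·ᵥ uprev n i +ᵥ a ·ᵥ u n i +ᵥ c ·ᵥ unext n i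
ladder-square-on-u {n} {e} {f} {α} {β} e-lowers f-raises s γ i {b} {a} {c} b≡ a≡ c≡ j = begin
  s ⊛ ρ n ((e ⊕ f ⊕ con γ) ⊗ (e ⊕ f ⊕ con (negᵢ γ))) (vℤ n k) j
    ≡⟨ cong (s ⊛_) (ladder-square e-lowers f-raises γ k j) ⟩
  s ⊛ (b′ ⊛ w₋ ⊹ a′ ⊛ w₀ ⊹ c′ ⊛ w₊)
    ≡⟨ distribute s b′ a′ c′ w₋ w₀ w₊ ⟩
  (s ⊛ b′) ⊛ w₋ ⊹ (s ⊛ a′) ⊛ w₀ ⊹ (s ⊛ c′) ⊛ w₊
    ≡⟨ cong₂ _⊹_ (cong₂ _⊹_ (cong₂ _⊛_ b≡ (sym (uprev≈vℤ n i j))) (cong (_⊛ w₀) a≡))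
                 (cong₂ _⊛_ c≡ (sym (unext≈vℤ n i j))) ⟩
  b ⊛ uprev n i j ⊹ a ⊛ u n i j ⊹ c ⊛ unext n i j ∎
  where
  open ≡-Reasoning
  k = + (2 ℕ.* i)
  b′ = α k ⊛ α (ℤ.pred k)
  a′ = α k ⊛ β (ℤ.pred k) ⊹ β k ⊛ α (ℤ.suc k) ⊹ negᵢ (γ ⊛ γ)
  c′ = β k ⊛ β (ℤ.suc k)
  w₋ = vℤ n (ℤ.pred (ℤ.pred k)) j
  w₀ = vℤ n k j
  w₊ = vℤ n (ℤ.suc (ℤ.suc k)) j
  distribute : ∀ s p q r x y z → s ⊛ (p ⊛ x ⊹ q ⊛ y ⊹ r ⊛ z) ≡ (s ⊛ p) ⊛ x ⊹ (s ⊛ q) ⊛ y ⊹ (s ⊛ r) ⊛ z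
  distribute = solve-∀ ℚi-ring

-- The coefficients a_i, b_i, c_i, θ*_i

1/16 : ℚi
1/16 = ι (+ 1 ℚ./ 16)

b-coefficient : ∀ n i → let k = + (2 ℕ.* i) in
  1/16 ⊛ (lowering n k ⊛ lowering n (ℤ.pred k)) ≡ ι (bcoef n i)
b-coefficient n i = begin
  1/16 ⊛ (ιℤ l ⊛ ιℤ l₋)  ≡⟨ cong (1/16 ⊛_) (sym (ιℤ-homo-* l l₋)) ⟩
  1/16 ⊛ ιℤ (l ℤ.* l₋)   ≡⟨ cong (λ z → 1/16 ⊛ ιℤ z) (ℤ-law (+ n) (+ (2 ℕ.* i))) ⟩
  1/16 ⊛ ιℤ numerator    ≡⟨ sym (ι-/ numerator 15) ⟩
  ι (bcoef n i)          ∎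
  where
  open ≡-Reasoning
  l  = + n ℤ.- ℤ.pred (+ (2 ℕ.* i))
  l₋ = + n ℤ.- ℤ.pred (ℤ.pred (+ (2 ℕ.* i)))
  numerator = (+ n ℤ.- + (2 ℕ.* i) ℤ.+ + 1) ℤ.* (+ n ℤ.- + (2 ℕ.* i) ℤ.+ + 2)
  ℤ-law : ∀ N K → (N ℤ.- (ℤ.-1ℤ ℤ.+ K)) ℤ.* (N ℤ.- (ℤ.-1ℤ ℤ.+ (ℤ.-1ℤ ℤ.+ K)))
                ≡ (N ℤ.- K ℤ.+ + 1) ℤ.* (N ℤ.- K ℤ.+ + 2)
  ℤ-law = ℤ-solve-∀

c-coefficient : ∀ n i → let k = + (2 ℕ.* i) in
  1/16 ⊛ (raising k ⊛ raising (ℤ.suc k)) ≡ ι (ccoef n i)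
c-coefficient n i = begin
  1/16 ⊛ (ιℤ (+ r) ⊛ ιℤ (+ r₊))  ≡⟨ cong (1/16 ⊛_) (sym (ιℤ-homo-* (+ r) (+ r₊))) ⟩
  1/16 ⊛ ιℤ (+ (r ℕ.* r₊))       ≡⟨ cong (λ z → 1/16 ⊛ ιℤ z) (trans (cong +_ (ℕ-law i)) (ℤP.pos-* 2 m)) ⟩
  1/16 ⊛ ιℤ (+ 2 ℤ.* + m)        ≡⟨ cong (1/16 ⊛_) (ιℤ-homo-* (+ 2) (+ m)) ⟩
  1/16 ⊛ (ιℤ (+ 2) ⊛ ιℤ (+ m))   ≡⟨ halve (ιℤ (+ m)) ⟩
  ι (+ 1 ℚ./ 8) ⊛ ιℤ (+ m)       ≡⟨ sym (ι-/ (+ m) 7) ⟩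
  ι (ccoef n i)                  ∎
  where
  open ≡-Reasoning
  r  = suc (2 ℕ.* i)
  r₊ = suc (suc (2 ℕ.* i))
  m  = suc i ℕ.* (2 ℕ.* i ℕ.+ 1)
  ℕ-law : ∀ i → suc (2 ℕ.* i) ℕ.* suc (suc (2 ℕ.* i)) ≡ 2 ℕ.* (suc i ℕ.* (2 ℕ.* i ℕ.+ 1))
  ℕ-law = ℕ-solve-∀
  halve : ∀ x → 1/16 ⊛ (ιℤ (+ 2) ⊛ x) ≡ ι (+ 1 ℚ./ 8) ⊛ x
  halve = solve-∀ ℚi-ring

a-coefficient : ∀ n i → let k = + (2 ℕ.* i) ; γ = ιℤ (ℤ.- + 2) in
  1/16 ⊛ (lowering n k ⊛ raising (ℤ.pred k) ⊹ raising k ⊛ lowering n (ℤ.suc k) ⊹ negᵢ (γ ⊛ γ)) ≡ ι (acoef n i)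
a-coefficient n i = begin
  1/16 ⊛ (ιℤ l ⊛ ιℤ r₋ ⊹ ιℤ r ⊛ ιℤ l₊ ⊹ negᵢ (ιℤ g ⊛ ιℤ g))
    ≡⟨ cong (1/16 ⊛_) (sym ιℤ-W) ⟩
  1/16 ⊛ ιℤ W
    ≡⟨ rescale (ιℤ W) ⟩
  ι (+ 1 ℚ./ 32) ⊛ (ιℤ (+ 2) ⊛ ιℤ W ⊹ ιℤ (+ 8)) ⊹ negᵢ (ι (+ 1 ℚ./ 4))
    ≡⟨ cong (λ z → ι (+ 1 ℚ./ 32) ⊛ z ⊹ negᵢ (ι (+ 1 ℚ./ 4))) (sym ιℤ-2W+8) ⟩
  ι (+ 1 ℚ./ 32) ⊛ ιℤ (+ 2 ℤ.* W ℤ.+ + 8) ⊹ negᵢ (ι (+ 1 ℚ./ 4))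
    ≡⟨ cong (λ z → ι (+ 1 ℚ./ 32) ⊛ ιℤ z ⊹ negᵢ (ι (+ 1 ℚ./ 4))) (sym numerator≡2W+8) ⟩
  ι (+ 1 ℚ./ 32) ⊛ ιℤ numerator ⊹ negᵢ (ι (+ 1 ℚ./ 4))
    ≡⟨ cong (_⊹ negᵢ (ι (+ 1 ℚ./ 4))) (sym (ι-/ numerator 31)) ⟩
  ι (acoef n i) ∎
  where
  open ≡-Reasoning
  N = + n
  K = + (2 ℕ.* i)
  l  = N ℤ.- ℤ.pred K
  r₋ = ℤ.suc (ℤ.pred K)
  r  = ℤ.suc K
  l₊ = N ℤ.- ℤ.pred (ℤ.suc K)
  g  = ℤ.- + 2
  W  = l ℤ.* r₋ ℤ.+ r ℤ.* l₊ ℤ.+ ℤ.- (g ℤ.* g)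
  numerator = + (n ℕ.* (n ℕ.+ 2)) ℤ.- d n i ℤ.* d n i

  ιℤ-W : ιℤ W ≡ ιℤ l ⊛ ιℤ r₋ ⊹ ιℤ r ⊛ ιℤ l₊ ⊹ negᵢ (ιℤ g ⊛ ιℤ g)
  ιℤ-W = trans (ιℤ-homo-+ (l ℤ.* r₋ ℤ.+ r ℤ.* l₊) (ℤ.- (g ℤ.* g)))
           (cong₂ _⊹_ (trans (ιℤ-homo-+ (l ℤ.* r₋) (r ℤ.* l₊)) (cong₂ _⊹_ (ιℤ-homo-* l r₋) (ιℤ-homo-* r l₊)))
                      (trans (ιℤ-homo-neg (g ℤ.* g)) (cong negᵢ (ιℤ-homo-* g g))))

  ιℤ-2W+8 : ιℤ (+ 2 ℤ.* W ℤ.+ + 8) ≡ ιℤ (+ 2) ⊛ ιℤ W ⊹ ιℤ (+ 8)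
  ιℤ-2W+8 = trans (ιℤ-homo-+ (+ 2 ℤ.* W) (+ 8)) (cong (_⊹ ιℤ (+ 8)) (ιℤ-homo-* (+ 2) W))

  ℤ-law : ∀ N K →
    N ℤ.* (N ℤ.+ + 2) ℤ.- (N ℤ.- + 2 ℤ.* K) ℤ.* (N ℤ.- + 2 ℤ.* K)
      ≡ + 2 ℤ.* ((N ℤ.- (ℤ.-1ℤ ℤ.+ K)) ℤ.* (+ 1 ℤ.+ (ℤ.-1ℤ ℤ.+ K))
                 ℤ.+ (+ 1 ℤ.+ K) ℤ.* (N ℤ.- (ℤ.-1ℤ ℤ.+ (+ 1 ℤ.+ K))) ℤ.+ ℤ.- (g ℤ.* g)) ℤ.+ + 8
  ℤ-law = ℤ-solve-∀

  numerator≡2W+8 : numerator ≡ + 2 ℤ.* W ℤ.+ + 8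
  numerator≡2W+8 = trans (cong₂ (λ a b → a ℤ.- (N ℤ.- b) ℤ.* (N ℤ.- b))
                                (trans (ℤP.pos-* n (n ℕ.+ 2)) (cong (N ℤ.*_) (ℤP.pos-+ n 2)))
                                (trans (cong +_ (ℕP.*-assoc 2 2 i)) (ℤP.pos-* 2 (2 ℕ.* i))))
                         (ℤ-law N K)

  rescale : ∀ x → 1/16 ⊛ x ≡ ι (+ 1 ℚ./ 32) ⊛ (ιℤ (+ 2) ⊛ x ⊹ ιℤ (+ 8)) ⊹ negᵢ (ι (+ 1 ℚ./ 4))
  rescale = solve-∀ ℚi-ring

θ*-coefficient : ∀ n i → let h = ιℤ (+ n ℤ.- + (2 ℕ.* (2 ℕ.* i))) in
  1/16 ⊛ ((h ⊹ ιℤ (+ 2)) ⊛ (h ⊹ ιℤ (ℤ.- + 2))) ≡ ι (θ* n i)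
θ*-coefficient n i = begin
  1/16 ⊛ ((h ⊹ ιℤ (+ 2)) ⊛ (h ⊹ ιℤ (ℤ.- + 2)))
    ≡⟨ cong (λ x → 1/16 ⊛ ((x ⊹ ιℤ (+ 2)) ⊛ (x ⊹ ιℤ (ℤ.- + 2)))) h≡D ⟩
  1/16 ⊛ ((D ⊹ ιℤ (+ 2)) ⊛ (D ⊹ ιℤ (ℤ.- + 2)))
    ≡⟨ difference-of-squares D ⟩
  1/16 ⊛ (D ⊛ D) ⊹ negᵢ (ι (+ 1 ℚ./ 4))
    ≡⟨ cong (λ x → 1/16 ⊛ x ⊹ negᵢ (ι (+ 1 ℚ./ 4))) (sym (ιℤ-homo-* (d n i) (d n i))) ⟩
  1/16 ⊛ ιℤ (d n i ℤ.* d n i) ⊹ negᵢ (ι (+ 1 ℚ./ 4))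
    ≡⟨ cong (_⊹ negᵢ (ι (+ 1 ℚ./ 4))) (sym (ι-/ (d n i ℤ.* d n i) 15)) ⟩
  ι (θ* n i) ∎
  where
  open ≡-Reasoning
  h = ιℤ (+ n ℤ.- + (2 ℕ.* (2 ℕ.* i)))
  D = ιℤ (d n i)
  h≡D : h ≡ D
  h≡D = cong (λ m → ιℤ (+ n ℤ.- + m)) (sym (ℕP.*-assoc 2 2 i))
  difference-of-squares : ∀ x → 1/16 ⊛ ((x ⊹ ιℤ (+ 2)) ⊛ (x ⊹ ιℤ (ℤ.- + 2))) ≡ 1/16 ⊛ (x ⊛ x) ⊹ negᵢ (ι (+ 1 ℚ./ 4))
  difference-of-squares = solve-∀ ℚi-ring

A-action : ∀ n i → act n A (u n i) ≈ᵥ ι (bcoef n i) ·ᵥ uprev n i +ᵥ ι (acoef n i) ·ᵥ u n i +ᵥ ι (ccoef n i) ·ᵥ unext n i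
A-action n i = ladder-square-on-u (E-lowers n) (F-raises n) 1/16 (ιℤ (ℤ.- + 2)) i
                 (b-coefficient n i) (a-coefficient n i) (c-coefficient n i)

C-action : ∀ n i →
  act n C (u n i) ≈ᵥ ι (ℚneg (bcoef n i)) ·ᵥ uprev n i +ᵥ ι (acoef n i) ·ᵥ u n i +ᵥ ι (ℚneg (ccoef n i)) ·ᵥ unext n i
C-action n i = ladder-square-on-u (Shifts-scale 𝐢 (E-lowers n)) (Shifts-scale -𝐢 (F-raises n)) 1/16 γ i
                 (trans (𝐢-square (lowering n k) (lowering n (ℤ.pred k))) (cong negᵢ (b-coefficient n i)))
                 (trans (𝐢-cross (lowering n k) (raising (ℤ.pred k)) (raising k) (lowering n (ℤ.suc k)) γ)
                        (a-coefficient n i))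
                 (trans (-𝐢-square (raising k) (raising (ℤ.suc k))) (cong negᵢ (c-coefficient n i)))
  where
  k = + (2 ℕ.* i)
  γ = ιℤ (ℤ.- + 2)
  -𝐢 = ιℤ (ℤ.- + 1) ⊛ 𝐢
  𝐢-square : ∀ x y → 1/16 ⊛ ((𝐢 ⊛ x) ⊛ (𝐢 ⊛ y)) ≡ negᵢ (1/16 ⊛ (x ⊛ y))
  𝐢-square = solve-∀ ℚi-ring
  -𝐢-square : ∀ x y → 1/16 ⊛ ((-𝐢 ⊛ x) ⊛ (-𝐢 ⊛ y)) ≡ negᵢ (1/16 ⊛ (x ⊛ y))
  -𝐢-square = solve-∀ ℚi-ring
  𝐢-cross : ∀ x₁ y₁ x₂ y₂ g →
    1/16 ⊛ ((𝐢 ⊛ x₁) ⊛ (-𝐢 ⊛ y₁) ⊹ (-𝐢 ⊛ x₂) ⊛ (𝐢 ⊛ y₂) ⊹ negᵢ (g ⊛ g)) ≡ 1/16 ⊛ (x₁ ⊛ y₁ ⊹ x₂ ⊛ y₂ ⊹ negᵢ (g ⊛ g))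
  𝐢-cross = solve-∀ ℚi-ring

B-action : ∀ n i → act n B (u n i) ≈ᵥ ι (θ* n i) ·ᵥ u n i
B-action n i j = begin
  1/16 ⊛ ρ n (H ⊕ con γ) (ρ n (H ⊕ con δ) (v n m)) j  ≡⟨ cong (1/16 ⊛_) (ρ-cong n (H ⊕ con γ) (eigen δ) j) ⟩
  1/16 ⊛ ρ n (H ⊕ con γ) ((h ⊹ δ) ·ᵥ v n m) j          ≡⟨ cong (1/16 ⊛_) (ρ-·ᵥ n (H ⊕ con γ) (h ⊹ δ) (v n m) j) ⟩
  1/16 ⊛ ((h ⊹ δ) ⊛ ρ n (H ⊕ con γ) (v n m) j)          ≡⟨ cong (λ x → 1/16 ⊛ ((h ⊹ δ) ⊛ x)) (eigen γ j) ⟩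
  1/16 ⊛ ((h ⊹ δ) ⊛ ((h ⊹ γ) ⊛ v n m j))                ≡⟨ reassociate 1/16 (h ⊹ δ) (h ⊹ γ) (v n m j) ⟩
  (1/16 ⊛ ((h ⊹ δ) ⊛ (h ⊹ γ))) ⊛ v n m j                ≡⟨ cong (_⊛ v n m j) (θ*-coefficient n i) ⟩
  ι (θ* n i) ⊛ v n m j                                  ∎
  where
  open ≡-Reasoning
  m = 2 ℕ.* i
  h = ιℤ (+ n ℤ.- + (2 ℕ.* m))
  γ = ιℤ (ℤ.- + 2)
  δ = ιℤ (+ 2)
  eigen : ∀ c → ρ n (H ⊕ con c) (v n m) ≈ᵥ (h ⊹ c) ·ᵥ v n m
  eigen c j = trans (cong (_⊹ c ⊛ v n m j) (H-v n m j)) (sym (distribʳ (v n m j) h c))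
  reassociate : ∀ s x y z → s ⊛ (x ⊛ (y ⊛ z)) ≡ (s ⊛ (x ⊛ y)) ⊛ z
  reassociate = solve-∀ ℚi-ring

proposition7p2 : (n i : ℕ) → i ≤ n / 2 →
    (act n A (u n i) ≈ᵥ ι (bcoef n i) ·ᵥ uprev n i +ᵥ ι (acoef n i) ·ᵥ u n i +ᵥ ι (ccoef n i) ·ᵥ unext n i)
    × (act n B (u n i) ≈ᵥ ι (θ* n i) ·ᵥ u n i)
    × (act n C (u n i) ≈ᵥ ι (ℚneg (bcoef n i)) ·ᵥ uprev n i +ᵥ ι (acoef n i) ·ᵥ u n i +ᵥ ι (ℚneg (ccoef n i)) ·ᵥ unext n i)
proposition7p2 n i _ = A-action n i , B-action n i , C-action n i
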